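{- Let $n\ge1$ and $S\subseteq[n]$. Write $S$ as a disjoint union of maximal blocks of consecutive integers $S=\bigsqcup_{j=1}^m B_j$, $B_j=\{i_j,i_j+1,\dots,i_j+l_j-1\}$ with $l_j\ge1$ and $i_j+l_j<i_{j+1}$. Define $\rho_S(i)=2i_j+l_j-i$ if $i\in B_j\cup\{i_j+l_j\}$ for some $j$, and $\rho_S(i)=i$ otherwise. Then the map $e\mapsto e'$ given by $e'_i=e_{\rho_S(i)}$ for $1\le i\le n$ is a bijection from $\{e\in\mathbf{I}_n:\mathrm{Em}^*(1\underline{01},e)\supseteq S\}$ to $\{e'\in\mathbf{I}_n:\mathrm{Em}^*(1\underline{10},e')\supseteq S\}$.
   Context: $\mathbf{I}_n$ is the set of integer sequences $e_1\dots e_n$ with $0\le e_i<i$. For $e\in\mathbf{I}_n$, $\mathrm{Em}^*(1\underline{01},e)$ is the set of $i\in[n-1]$ for which there exists $t<i$ with $e_i<e_{i+1}=e_t$, and $\mathrm{Em}^*(1\underline{10},e)$ is the set of $i\in[n-1]$ for which there exists $t<i$ with $e_t=e_i>e_{i+1}$. -}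

module Defs where

open import Data.Nat using (ℕ; zero; suc; _+_; _∸_; _≤_; _<_; _<?_)
open import Data.Bool using (Bool; true; false; if_then_else_)
open import Data.Fin using (Fin; toℕ; fromℕ<)
open import Data.Fin.Subset using (Subset; _∈_)
open import Data.Vec using (Vec; lookup; tabulate)
open import Data.Product using (Σ; _×_; ∃)
open import Relation.Nullary using (yes; no)
open import Relation.Binary.PropositionalEquality using (_≡_)

-- Sequences e = e₁ … eₙ are vectors; entry eᵢ (1-indexed) is lookup e (i-1).
-- 1-indexed access, returning 0 outside [1,n] (never used inside the domain).
at : ∀ {n} → Vec ℕ n → ℕ → ℕ
at {n} e zero = 0
at {n} e (suc k) with k <? n
... | yes p = lookup e (fromℕ< p)
... | no _  = 0

InversionSeq : ∀ n → Vec ℕ n → Set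
InversionSeq n e = ∀ (k : Fin n) → lookup e k < suc (toℕ k)

InEm101 : ∀ {n} → Vec ℕ n → ℕ → Set
InEm101 {n} e i = (1 ≤ i) × (i ≤ n ∸ 1) ×
  ∃ λ t → (1 ≤ t) × (t < i) × (at e i < at e (suc i)) × (at e (suc i) ≡ at e t)

InEm110 : ∀ {n} → Vec ℕ n → ℕ → Set
InEm110 {n} e i = (1 ≤ i) × (i ≤ n ∸ 1) ×
  ∃ λ t → (1 ≤ t) × (t < i) × (at e t ≡ at e i) × (at e (suc i) < at e i)

-- Subsets S ⊆ [n]: element k : Fin n represents the integer k+1.
-- 1-indexed membership test (false outside [1,n]).
inS : ∀ {n} → Subset n → ℕ → Bool
inS {n} S zero = false
inS {n} S (suc k) with k <? n
... | yes p = lookup S (fromℕ< p)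
... | no _  = false

SubsetOfEm101 : ∀ {n} → Subset n → Vec ℕ n → Set
SubsetOfEm101 {n} S e = ∀ (k : Fin n) → k ∈ S → InEm101 e (suc (toℕ k))

SubsetOfEm110 : ∀ {n} → Subset n → Vec ℕ n → Set
SubsetOfEm110 {n} S e = ∀ (k : Fin n) → k ∈ S → InEm110 e (suc (toℕ k))

blockStart : ∀ {n} → Subset n → ℕ → ℕ
blockStart S zero = zero
blockStart S (suc k) = if inS S k then blockStart S k else suc k

blockEndF : ∀ {n} → Subset n → ℕ → ℕ → ℕ
blockEndF S zero i = i
blockEndF S (suc f) i = if inS S i then blockEndF S f (suc i) else i

blockEnd : ∀ {n} → Subset n → ℕ → ℕ
blockEnd {n} S i = blockEndF S (suc n) i

-- ρ_S(i) = 2 i_j + l_j - i = i_j + (i_j + l_j) - i  if i ∈ B_j ∪ {i_j + l_j},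
-- and ρ_S(i) = i otherwise.
ρ : ∀ {n} → Subset n → ℕ → ℕ
ρ S i = if inS S i
        then blockStart S i + blockEnd S i ∸ i
        else (if inS S (i ∸ 1)
              then blockStart S (i ∸ 1) + blockEnd S (i ∸ 1) ∸ i
              else i)

flipMap : ∀ {n} → Subset n → Vec ℕ n → Vec ℕ n
flipMap {n} S e = tabulate λ (k : Fin n) → at e (ρ S (suc (toℕ k)))

module Submission where

-- Decompose S into maximal runs [a, b) (so a ∸ 1 ∉ S and b ∉ S).
-- ρ_S reflects each closed run [a, b] by k ↦ a + b ∸ k and fixes every other
-- position, so ρ_S is an involution which maps [1, a) into itself.  If
-- S ⊆ Em*(1 0̲1̲, e), then e is strictly increasing along every closed run
-- [a, b]; a strictly monotone run repeats no value, so the Em-witness of each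
-- e_x with a < x ≤ b lies before a, and the inversion condition forces all
-- values of e on [a, b] below a.  Hence e' = e ∘ ρ_S is again an inversion
-- sequence, and for i ∈ S the reflected pair (e'_i, e'_{i+1}) = (e_{m+1}, e_m)
-- is a descent whose top value recurs before i (at the ρ_S-image of the early
-- witness), i.e. i ∈ Em*(1 1̲0̲, e').  The direction 1 1̲0̲ → 1 0̲1̲ is the
-- mirror argument with decreasing runs.  Since ρ_S is an involution of [1, n],
-- so is e ↦ e', which gives injectivity and surjectivity at once.

open import Defs
open import Data.Bool using (Bool; true; false; if_then_else_)
open import Data.Empty using (⊥-elim)
open import Data.Fin using (Fin; toℕ; fromℕ<)
open import Data.Fin.Properties using (toℕ<n; toℕ-fromℕ<; fromℕ<-toℕ)
open import Data.Fin.Subset using (Subset; _∈_)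
open import Data.Nat
open import Data.Nat.Properties
open import Data.Product using (Σ; ∃; _×_; _,_; proj₁; proj₂)
open import Data.Sum using (inj₁; inj₂)
open import Data.Vec using (Vec; lookup; tabulate)
open import Data.Vec.Properties using (lookup⇒[]=; []=⇒lookup; tabulate∘lookup; tabulate-cong; lookup∘tabulate)
open import Relation.Nullary using (yes; no)
open import Relation.Binary.PropositionalEquality

if-true : ∀ {A : Set} {b : Bool} {x y : A} → b ≡ true → (if b then x else y) ≡ x
if-true refl = refl

if-false : ∀ {A : Set} {b : Bool} {x y : A} → b ≡ false → (if b then x else y) ≡ y
if-false refl = refl

true≢false : true ≢ false
true≢false ()

module Reflection {a b k : ℕ} (a≤k : a ≤ k) (k≤b : k ≤ b) where
  k≤a+b : k ≤ a + b
  k≤a+b = ≤-trans k≤b (m≤n+m b a)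

  reflect≥ : a ≤ a + b ∸ k
  reflect≥ = begin
    a          ≡⟨ m+n∸n≡m a b ⟨
    a + b ∸ b  ≤⟨ ∸-monoʳ-≤ (a + b) k≤b ⟩
    a + b ∸ k  ∎
    where open ≤-Reasoning

  reflect≤ : a + b ∸ k ≤ b
  reflect≤ = begin
    a + b ∸ k  ≤⟨ ∸-monoʳ-≤ (a + b) a≤k ⟩
    a + b ∸ a  ≡⟨ m+n∸m≡n a b ⟩
    b          ∎
    where open ≤-Reasoning

  reflect-involutive : a + b ∸ (a + b ∸ k) ≡ k
  reflect-involutive = m∸[m∸n]≡n k≤a+b

∸-suc : ∀ c i → suc i ≤ c → c ∸ i ≡ suc (c ∸ suc i)
∸-suc c i = +-∸-assoc 1

≤∸1⇒< : ∀ {i n} → 1 ≤ i → i ≤ n ∸ 1 → i < n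
≤∸1⇒< {n = zero}  1≤i i≤0 = ⊥-elim (n≮0 (≤-trans 1≤i i≤0))
≤∸1⇒< {n = suc n} _   i≤n = s≤s i≤n

<⇒≤∸1 : ∀ {i n} → i < n → i ≤ n ∸ 1
<⇒≤∸1 (s≤s i≤n) = i≤n

∸1< : ∀ {n} → 1 ≤ n → n ∸ 1 < n
∸1< (s≤s z≤n) = ≤-refl

module Runs {n : ℕ} (S : Subset n) where

  inS-bounds : ∀ i → inS S i ≡ true → 1 ≤ i × i ≤ n
  inS-bounds zero    ()
  inS-bounds (suc k) i∈S with k <? n
  ... | yes k<n = s≤s z≤n , k<n
  ... | no  _   with i∈S
  ...   | ()

  inS-beyond : ∀ i → n < i → inS S i ≡ false
  inS-beyond i n<i with inS S i in i∈S
  ... | false = refl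
  ... | true  = ⊥-elim (<⇒≱ n<i (proj₂ (inS-bounds i i∈S)))

  record Run (a b : ℕ) : Set where
    field
      1≤a    : 1 ≤ a
      a<b    : a < b
      before : inS S (a ∸ 1) ≡ false
      after  : inS S b ≡ false
      inside : ∀ j → a ≤ j → j < b → inS S j ≡ true
  open Run public

  last-inside : ∀ {a b} → Run a b → Σ ℕ λ l → suc l ≡ b × a ≤ l × inS S l ≡ true
  last-inside {a} {zero}  R = ⊥-elim (n≮0 (a<b R))
  last-inside {a} {suc l} R = l , refl , ≤-pred (a<b R) , inside R l (≤-pred (a<b R)) ≤-refl

  extend-right : ∀ {s k} {P : ℕ → Set} → (∀ j → s ≤ j → j ≤ k → P j) → P (suc k) →
    ∀ j → s ≤ j → j ≤ suc k → P j
  extend-right below top j s≤j j≤k+1 with m≤n⇒m<n∨m≡n j≤k+1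
  ... | inj₁ j<k+1 = below j s≤j (≤-pred j<k+1)
  ... | inj₂ refl  = top

  extend-left : ∀ {i e} {P : ℕ → Set} → P i → (∀ j → suc i ≤ j → j < e → P j) →
    ∀ j → i ≤ j → j < e → P j
  extend-left bottom above j i≤j j<e with m≤n⇒m<n∨m≡n i≤j
  ... | inj₁ i<j = above j i<j j<e
  ... | inj₂ refl = bottom

  blockStart-spec : ∀ k → inS S k ≡ true →
    blockStart S k ≤ k × inS S (blockStart S k ∸ 1) ≡ false ×
    (∀ j → blockStart S k ≤ j → j ≤ k → inS S j ≡ true)
  blockStart-spec zero    ()
  blockStart-spec (suc k) k+1∈S with inS S k in k∈S
  ... | true  = let (s≤k , start , members) = blockStart-spec k k∈S in
    m≤n⇒m≤1+n s≤k , start , extend-right members k+1∈S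
  ... | false = ≤-refl , k∈S , λ j k+1≤j j≤k+1 → subst (λ x → inS S x ≡ true) (≤-antisym k+1≤j j≤k+1) k+1∈S

  blockEndF-spec : ∀ f i → i ≤ blockEndF S f i × (∀ j → i ≤ j → j < blockEndF S f i → inS S j ≡ true)
    × (n < f + i → inS S (blockEndF S f i) ≡ false)
  blockEndF-spec zero    i = ≤-refl , (λ j i≤j j<i → ⊥-elim (<⇒≱ j<i i≤j)) , inS-beyond i
  blockEndF-spec (suc f) i with inS S i in i∈S
  ... | false = ≤-refl , (λ j i≤j j<i → ⊥-elim (<⇒≱ j<i i≤j)) , λ _ → i∈S
  ... | true  = let (i+1≤e , members , stop) = blockEndF-spec f (suc i) in
    ≤-trans (n≤1+n i) i+1≤e , extend-left i∈S members ,
    λ n<f+i+1 → stop (subst (n <_) (sym (+-suc f i)) n<f+i+1)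

  blockStart-run : ∀ {a b} → Run a b → ∀ k → a ≤ k → k < b → blockStart S k ≡ a
  blockStart-run R zero    a≤0 _ = ⊥-elim (n≮0 (≤-trans (1≤a R) a≤0))
  blockStart-run {a} R (suc k) a≤k+1 k+1<b with a ≤? k
  ... | yes a≤k = trans (if-true (inside R k a≤k k<b)) (blockStart-run R k a≤k k<b)
    where k<b = ≤-trans (n≤1+n (suc k)) k+1<b
  ... | no  a≰k = trans (if-false k∉S) (sym a≡k+1)
    where
    a≡k+1 : a ≡ suc k
    a≡k+1 = ≤-antisym a≤k+1 (≰⇒> a≰k)
    k∉S : inS S k ≡ false
    k∉S = subst (λ x → inS S (x ∸ 1) ≡ false) a≡k+1 (before R)

  blockEndF-run : ∀ {a b} → Run a b → ∀ f k → a ≤ k → k ≤ b → b ≤ f + k → blockEndF S f k ≡ b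
  blockEndF-run R zero    k _   k≤b b≤k = ≤-antisym k≤b b≤k
  blockEndF-run {b = b} R (suc f) k a≤k k≤b b≤f+k+1 with m≤n⇒m<n∨m≡n k≤b
  ... | inj₁ k<b rewrite inside R k a≤k k<b =
    blockEndF-run R f (suc k) (m≤n⇒m≤1+n a≤k) k<b (subst (b ≤_) (sym (+-suc f k)) b≤f+k+1)
  ... | inj₂ refl rewrite after R = refl

  run-end≤ : ∀ {a b} → Run a b → b ≤ suc n
  run-end≤ R with last-inside R
  ... | l , refl , _ , l∈S = s≤s (proj₂ (inS-bounds l l∈S))

  run-ends : ∀ {a b} → Run a b → ∀ k → a ≤ k → k < b → blockStart S k + blockEnd S k ≡ a + b
  run-ends R k a≤k k<b = cong₂ _+_ (blockStart-run R k a≤k k<b)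
    (blockEndF-run R (suc n) k a≤k (<⇒≤ k<b) (≤-trans (run-end≤ R) (m≤m+n (suc n) k)))

  ρ-run : ∀ {a b} → Run a b → ∀ k → a ≤ k → k ≤ b → ρ S k ≡ a + b ∸ k
  ρ-run R k a≤k k≤b with m≤n⇒m<n∨m≡n k≤b
  ... | inj₁ k<b = trans (if-true (inside R k a≤k k<b)) (cong (_∸ k) (run-ends R k a≤k k<b))
  ... | inj₂ refl with last-inside R
  ...   | l , refl , a≤l , l∈S =
    trans (if-false (after R)) (trans (if-true l∈S) (cong (_∸ suc l) (run-ends R l a≤l ≤-refl)))

  runOf : ∀ k → inS S k ≡ true → Run (blockStart S k) (blockEnd S k) × blockStart S k ≤ k × k < blockEnd S k
  runOf k k∈S = run , s≤k , k<e
    where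
    start = blockStart-spec k k∈S
    s≤k = proj₁ start
    end = blockEndF-spec (suc n) k
    stop : inS S (blockEnd S k) ≡ false
    stop = proj₂ (proj₂ end) (m≤m+n (suc n) k)
    k<e : k < blockEnd S k
    k<e = ≤∧≢⇒< (proj₁ end) (λ k≡e → true≢false (trans (sym k∈S) (trans (cong (inS S) k≡e) stop)))
    members : ∀ j → blockStart S k ≤ j → j < blockEnd S k → inS S j ≡ true
    members j s≤j j<e with j ≤? k
    ... | yes j≤k = proj₂ (proj₂ start) j s≤j j≤k
    ... | no  j≰k = proj₁ (proj₂ end) j (<⇒≤ (≰⇒> j≰k)) j<e
    run : Run (blockStart S k) (blockEnd S k)
    run = record
      { 1≤a = proj₁ (inS-bounds _ (members _ ≤-refl (≤-<-trans s≤k k<e)))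
      ; a<b = ≤-<-trans s≤k k<e
      ; before = proj₁ (proj₂ start)
      ; after = stop
      ; inside = members }

  data Position (j : ℕ) : Set where
    inRun   : ∀ {a b} → Run a b → a ≤ j → j ≤ b → Position j
    outside : inS S j ≡ false → inS S (j ∸ 1) ≡ false → Position j

  position : ∀ j → Position j
  position j with inS S j in j∈S
  ... | true = let (R , s≤j , j<e) = runOf j j∈S in inRun R s≤j (<⇒≤ j<e)
  ... | false with inS S (j ∸ 1) in j-1∈S
  ...   | false = outside j∈S j-1∈S
  ...   | true  = inRun R (≤-trans s≤j-1 (m∸n≤m j 1)) j≤e
    where
    run = runOf (j ∸ 1) j-1∈S
    R = proj₁ run
    s≤j-1 = proj₁ (proj₂ run)
    j≤e : j ≤ blockEnd S (j ∸ 1)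
    j≤e = ≤-trans (m≤n+m∸n j 1) (proj₂ (proj₂ run))

  ρ-outside : ∀ j → inS S j ≡ false → inS S (j ∸ 1) ≡ false → ρ S j ≡ j
  ρ-outside j j∉S j-1∉S = trans (if-false j∉S) (if-false j-1∉S)

  ρ-involutive : ∀ j → ρ S (ρ S j) ≡ j
  ρ-involutive j with position j
  ... | outside j∉S j-1∉S = trans (cong (ρ S) (ρ-outside j j∉S j-1∉S)) (ρ-outside j j∉S j-1∉S)
  ... | inRun R a≤j j≤b = let open Reflection a≤j j≤b in
    trans (cong (ρ S) (ρ-run R j a≤j j≤b)) (trans (ρ-run R _ reflect≥ reflect≤) reflect-involutive)

  -- ρ_S maps the positions before a run into themselves: an earlier run ends
  -- before a, because a ∸ 1 ∉ S.
  ρ-early : ∀ {a b} → Run a b → ∀ t → 1 ≤ t → t < a → 1 ≤ ρ S t × ρ S t < a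
  ρ-early R t 1≤t t<a with position t
  ... | outside t∉S t-1∉S rewrite ρ-outside t t∉S t-1∉S = 1≤t , t<a
  ... | inRun R′ a′≤t t≤b′ rewrite ρ-run R′ t a′≤t t≤b′ =
    let open Reflection a′≤t t≤b′ in
    ≤-trans (1≤a R′) reflect≥ , ≤-<-trans reflect≤ (earlier-run-ends R R′ a′≤t t<a)
    where
    earlier-run-ends : ∀ {a b a′ b′} → Run a b → Run a′ b′ → a′ ≤ t → t < a → b′ < a
    earlier-run-ends {a} {b′ = b′} R R′ a′≤t t<a with a ≤? b′
    ... | no  a≰b′ = ≰⇒> a≰b′
    ... | yes a≤b′ = ⊥-elim (true≢false (trans (sym a-1∈S) (before R)))
      where
      a-1∈S : inS S (a ∸ 1) ≡ true
      a-1∈S = inside R′ (a ∸ 1) (≤-trans a′≤t (<⇒≤∸1 t<a)) (<-≤-trans (∸1< (1≤a R)) a≤b′)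

fromFin : ∀ {n} {P : ℕ → Set} → (∀ (k : Fin n) → P (suc (toℕ k))) → ∀ i → 1 ≤ i → i ≤ n → P i
fromFin {P = P} h (suc j) _ j<n = subst (λ x → P (suc x)) (toℕ-fromℕ< j<n) (h (fromℕ< j<n))

at-fin : ∀ {n} (e : Vec ℕ n) (k : Fin n) → at e (suc (toℕ k)) ≡ lookup e k
at-fin {n} e k with toℕ k <? n
... | yes k<n = cong (lookup e) (fromℕ<-toℕ k k<n)
... | no  k≮n = ⊥-elim (k≮n (toℕ<n k))

inS-fin : ∀ {n} (S : Subset n) (k : Fin n) → inS S (suc (toℕ k)) ≡ lookup S k
inS-fin {n} S k with toℕ k <? n
... | yes k<n = cong (lookup S) (fromℕ<-toℕ k k<n)
... | no  k≮n = ⊥-elim (k≮n (toℕ<n k))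

vec-ext : ∀ {n} (x y : Vec ℕ n) → (∀ i → 1 ≤ i → i ≤ n → at x i ≡ at y i) → x ≡ y
vec-ext x y same = begin
  x                   ≡⟨ tabulate∘lookup x ⟨
  tabulate (lookup x) ≡⟨ tabulate-cong entry ⟩
  tabulate (lookup y) ≡⟨ tabulate∘lookup y ⟩
  y                   ∎
  where
  open ≡-Reasoning
  entry : ∀ k → lookup x k ≡ lookup y k
  entry k = trans (sym (at-fin x k)) (trans (same _ (s≤s z≤n) (toℕ<n k)) (at-fin y k))

Inversion : ∀ n → Vec ℕ n → Set
Inversion n e = ∀ i → 1 ≤ i → i ≤ n → at e i < i

inversion→ : ∀ {n} (e : Vec ℕ n) → InversionSeq n e → Inversion n e
inversion→ e inv = fromFin λ k → subst (_< suc (toℕ k)) (sym (at-fin e k)) (inv k)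

inversion← : ∀ {n} (e : Vec ℕ n) → Inversion n e → InversionSeq n e
inversion← e inv k = subst (_< suc (toℕ k)) (at-fin e k) (inv _ (s≤s z≤n) (toℕ<n k))

at-flip : ∀ {n} (S : Subset n) (e : Vec ℕ n) → ∀ i → 1 ≤ i → i ≤ n → at (flipMap S e) i ≡ at e (ρ S i)
at-flip S e = fromFin λ k → trans (at-fin (flipMap S e) k) (lookup∘tabulate _ k)

members→ : ∀ {n} (S : Subset n) {P : ℕ → Set} →
  (∀ (k : Fin n) → k ∈ S → P (suc (toℕ k))) → ∀ i → inS S i ≡ true → P i
members→ S {P} h i i∈S = fromFin {P = λ i → inS S i ≡ true → P i}
  (λ k k∈S → h k (lookup⇒[]= k S (trans (sym (inS-fin S k)) k∈S)))
  i 1≤i i≤n i∈S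
  where open Runs S using (inS-bounds)
        1≤i = proj₁ (inS-bounds i i∈S)
        i≤n = proj₂ (inS-bounds i i∈S)

members← : ∀ {n} (S : Subset n) {P : ℕ → Set} →
  (∀ i → inS S i ≡ true → P i) → ∀ (k : Fin n) → k ∈ S → P (suc (toℕ k))
members← S h k k∈S = h _ (trans (inS-fin S k) ([]=⇒lookup k∈S))

chain : (R : ℕ → ℕ → Set) → (∀ {x y z} → R x y → R y z → R x z) → (F : ℕ → ℕ) → ∀ {a b} →
  (∀ x → a ≤ x → x < b → R (F x) (F (suc x))) → ∀ {x y} → a ≤ x → x < y → y ≤ b → R (F x) (F y)
chain R R-trans F step {x} {suc y} a≤x x<y+1 y+1≤b with m≤n⇒m<n∨m≡n (≤-pred x<y+1)
... | inj₁ x<y  = R-trans (chain R R-trans F step a≤x x<y (<⇒≤ y+1≤b)) (step y (≤-trans a≤x (<⇒≤ x<y)) y+1≤b)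
... | inj₂ refl = step x a≤x y+1≤b

-- From here on all members of S are < n, as S ⊆ Em*(…) forces.
module Bounded {n : ℕ} (S : Subset n) (bounded : ∀ i → inS S i ≡ true → i < n) where
  open Runs S

  run-end≤n : ∀ {a b} → Run a b → b ≤ n
  run-end≤n R with last-inside R
  ... | l , refl , _ , l∈S = bounded l l∈S

  run-start≤n : ∀ {a b} → Run a b → a ≤ n
  run-start≤n R = ≤-trans (<⇒≤ (a<b R)) (run-end≤n R)

  ρ-range : ∀ j → 1 ≤ j → j ≤ n → 1 ≤ ρ S j × ρ S j ≤ n
  ρ-range j 1≤j j≤n with position j
  ... | outside j∉S j-1∉S rewrite ρ-outside j j∉S j-1∉S = 1≤j , j≤n
  ... | inRun R a≤j j≤b rewrite ρ-run R j a≤j j≤b = let open Reflection a≤j j≤b in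
    ≤-trans (1≤a R) reflect≥ , ≤-trans reflect≤ (run-end≤n R)

  flipMap-involutive : ∀ e → flipMap S (flipMap S e) ≡ e
  flipMap-involutive e = vec-ext _ e λ j 1≤j j≤n →
    let (1≤ρj , ρj≤n) = ρ-range j 1≤j j≤n in begin
      at (flipMap S (flipMap S e)) j ≡⟨ at-flip S (flipMap S e) j 1≤j j≤n ⟩
      at (flipMap S e) (ρ S j)       ≡⟨ at-flip S e (ρ S j) 1≤ρj ρj≤n ⟩
      at e (ρ S (ρ S j))             ≡⟨ cong (at e) (ρ-involutive j) ⟩
      at e j                         ∎
    where open ≡-Reasoning

  Early : Vec ℕ n → ℕ → ℕ → Set
  Early e a v = Σ ℕ λ t → 1 ≤ t × t < a × at e t ≡ v

  flip-early : ∀ {a b} → Run a b → ∀ e {v} → Early e a v → Early (flipMap S e) a v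
  flip-early R e {v} (t , 1≤t , t<a , eₜ≡v) = ρ S t , 1≤ρt , ρt<a , (begin
      at (flipMap S e) (ρ S t) ≡⟨ at-flip S e (ρ S t) 1≤ρt (<⇒≤ (<-≤-trans ρt<a (run-start≤n R))) ⟩
      at e (ρ S (ρ S t))       ≡⟨ cong (at e) (ρ-involutive t) ⟩
      at e t                   ≡⟨ eₜ≡v ⟩
      v                        ∎)
    where
    open ≡-Reasoning
    1≤ρt = proj₁ (ρ-early R t 1≤t t<a)
    ρt<a = proj₂ (ρ-early R t 1≤t t<a)

  early-value< : ∀ {a b e v} → Inversion n e → Run a b → Early e a v → v < a
  early-value< inv R (t , 1≤t , t<a , eₜ≡v) =
    subst (_< _) eₜ≡v (<-trans (inv t 1≤t (<⇒≤ (<-≤-trans t<a (run-start≤n R)))) t<a)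

  flip-inversion : ∀ e → Inversion n e →
    (∀ {a b} → Run a b → ∀ x → a ≤ x → x ≤ b → at e x < a) → InversionSeq n (flipMap S e)
  flip-inversion e inv small = inversion← (flipMap S e) λ i 1≤i i≤n →
    subst (_< i) (sym (at-flip S e i 1≤i i≤n)) (reflected i 1≤i i≤n)
    where
    reflected : ∀ i → 1 ≤ i → i ≤ n → at e (ρ S i) < i
    reflected i 1≤i i≤n with position i
    ... | outside i∉S i-1∉S rewrite ρ-outside i i∉S i-1∉S = inv i 1≤i i≤n
    ... | inRun R a≤i i≤b rewrite ρ-run R i a≤i i≤b = let open Reflection a≤i i≤b in
      <-≤-trans (small R _ reflect≥ reflect≤) a≤i

  record Mirror (e : Vec ℕ n) (i : ℕ) : Set where
    field
      start end m : ℕ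
      run       : Run start end
      start≤i   : start ≤ i
      start≤m   : start ≤ m
      m<end     : m < end
      flip-i    : at (flipMap S e) i ≡ at e (suc m)
      flip-i+1  : at (flipMap S e) (suc i) ≡ at e m

  mirror : ∀ e i → inS S i ≡ true → Mirror e i
  mirror e i i∈S = record
    { run = R ; start≤i = a≤i ; start≤m = A₁.reflect≥ ; m<end = m<b
    ; flip-i   = trans (at-flip S e i 1≤i (<⇒≤ i<n)) (cong (at e) ρi≡m+1)
    ; flip-i+1 = trans (at-flip S e (suc i) (s≤s z≤n) i<n)
                       (cong (at e) (ρ-run R (suc i) (m≤n⇒m≤1+n a≤i) i<b)) }
    where
    R = proj₁ (runOf i i∈S)
    a≤i = proj₁ (proj₂ (runOf i i∈S))
    i<b = proj₂ (proj₂ (runOf i i∈S))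
    1≤i = proj₁ (inS-bounds i i∈S)
    i<n = bounded i i∈S
    a = blockStart S i
    b = blockEnd S i
    module A₀ = Reflection a≤i (<⇒≤ i<b)
    module A₁ = Reflection (m≤n⇒m≤1+n a≤i) i<b
    reflect-i : a + b ∸ i ≡ suc (a + b ∸ suc i)
    reflect-i = ∸-suc (a + b) i A₁.k≤a+b
    ρi≡m+1 : ρ S i ≡ suc (a + b ∸ suc i)
    ρi≡m+1 = trans (ρ-run R i a≤i (<⇒≤ i<b)) reflect-i
    m<b : a + b ∸ suc i < b
    m<b = subst (_≤ b) reflect-i A₀.reflect≤

module Forward {n : ℕ} (S : Subset n) (e : Vec ℕ n) (inv₀ : InversionSeq n e) (em₀ : SubsetOfEm101 S e) where
  open Runs S

  em : ∀ i → inS S i ≡ true → InEm101 e i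
  em = members→ S em₀

  bounded : ∀ i → inS S i ≡ true → i < n
  bounded i i∈S = let (1≤i , i≤n-1 , _) = em i i∈S in ≤∸1⇒< 1≤i i≤n-1

  open Bounded S bounded

  inv : Inversion n e
  inv = inversion→ e inv₀

  rising : ∀ x → inS S x ≡ true → at e x < at e (suc x)
  rising x x∈S = let (_ , _ , _ , _ , _ , up , _) = em x x∈S in up

  -- The witness t of x ∸ 1 ∈ Em* cannot lie in the increasing run, so the
  -- value at x > a already occurred before a.
  early : ∀ {a b} → Run a b → ∀ x → a < x → x ≤ b → Early e a (at e x)
  early {a} R (suc y) (s≤s a≤y) y<b with em y (inside R y a≤y y<b)
  ... | _ , _ , t , 1≤t , t<y , _ , repeat with a ≤? t
  ...   | no  a≰t = t , 1≤t , ≰⇒> a≰t , sym repeat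
  ...   | yes a≤t = ⊥-elim (<⇒≢ increase (sym repeat))
    where
    increase : at e t < at e (suc y)
    increase = chain _<_ <-trans (at e) (λ x a≤x x<b → rising x (inside R x a≤x x<b))
                 a≤t (m<n⇒m<1+n t<y) y<b

  -- All values on a run closure are below its start (at x = a by the inversion
  -- condition, elsewhere as early values).
  small : ∀ {a b} → Run a b → ∀ x → a ≤ x → x ≤ b → at e x < a
  small R x a≤x x≤b with m≤n⇒m<n∨m≡n a≤x
  ... | inj₁ a<x  = early-value< inv R (early R x a<x x≤b)
  ... | inj₂ refl = inv x (1≤a R) (run-start≤n R)

  -- The reflected pair (e_{m+1}, e_m) is a descent whose top recurs early.
  flip-em : ∀ i → inS S i ≡ true → InEm110 (flipMap S e) i
  flip-em i i∈S =
    let open Mirror (mirror e i i∈S)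
        (1≤i , i≤n-1 , _) = em i i∈S
        (t , 1≤t , t<start , repeat) = flip-early run e (early run (suc m) (s≤s start≤m) m<end)
    in 1≤i , i≤n-1 , t , 1≤t , <-≤-trans t<start start≤i , trans repeat (sym flip-i) ,
       subst₂ _<_ (sym flip-i+1) (sym flip-i) (rising m (inside run m start≤m m<end))

  result : InversionSeq n (flipMap S e) × SubsetOfEm110 S (flipMap S e)
  result = flip-inversion e inv small , members← S flip-em

module Backward {n : ℕ} (S : Subset n) (e : Vec ℕ n) (inv₀ : InversionSeq n e) (em₀ : SubsetOfEm110 S e) where
  open Runs S

  em : ∀ i → inS S i ≡ true → InEm110 e i
  em = members→ S em₀

  bounded : ∀ i → inS S i ≡ true → i < n
  bounded i i∈S = let (1≤i , i≤n-1 , _) = em i i∈S in ≤∸1⇒< 1≤i i≤n-1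

  open Bounded S bounded

  inv : Inversion n e
  inv = inversion→ e inv₀

  falling : ∀ x → inS S x ≡ true → at e (suc x) < at e x
  falling x x∈S = let (_ , _ , _ , _ , _ , _ , down) = em x x∈S in down

  -- The witness t of x ∈ Em* cannot lie in the decreasing run, so the value
  -- at x < b already occurred before a.
  early : ∀ {a b} → Run a b → ∀ x → a ≤ x → x < b → Early e a (at e x)
  early {a} R x a≤x x<b with em x (inside R x a≤x x<b)
  ... | _ , _ , t , 1≤t , t<x , repeat , _ with a ≤? t
  ...   | no  a≰t = t , 1≤t , ≰⇒> a≰t , repeat
  ...   | yes a≤t = ⊥-elim (>⇒≢ decrease repeat)
    where
    decrease : at e x < at e t
    decrease = chain _>_ (λ p q → <-trans q p) (at e) (λ y a≤y y<b → falling y (inside R y a≤y y<b))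
                 a≤t t<x (<⇒≤ x<b)

  -- All values on a run closure are below its start (at x = b because e
  -- descends from the early value at b ∸ 1).
  small : ∀ {a b} → Run a b → ∀ x → a ≤ x → x ≤ b → at e x < a
  small R x a≤x x≤b with m≤n⇒m<n∨m≡n x≤b
  ... | inj₁ x<b  = early-value< inv R (early R x a≤x x<b)
  ... | inj₂ refl with last-inside R
  ...   | l , refl , a≤l , l∈S = <-trans (falling l l∈S) (early-value< inv R (early R l a≤l ≤-refl))

  -- The reflected pair (e_{m+1}, e_m) is an ascent whose top recurs early.
  flip-em : ∀ i → inS S i ≡ true → InEm101 (flipMap S e) i
  flip-em i i∈S =
    let open Mirror (mirror e i i∈S)
        (1≤i , i≤n-1 , _) = em i i∈S
        (t , 1≤t , t<start , repeat) = flip-early run e (early run m start≤m m<end)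
    in 1≤i , i≤n-1 , t , 1≤t , <-≤-trans t<start start≤i ,
       subst₂ _<_ (sym flip-i) (sym flip-i+1) (falling m (inside run m start≤m m<end)) ,
       trans flip-i+1 (sym repeat)

  result : InversionSeq n (flipMap S e) × SubsetOfEm101 S (flipMap S e)
  result = flip-inversion e inv small , members← S flip-em

lemma3p5 : ∀ (n : ℕ) → 1 ≤ n → (S : Subset n) →
    (∀ (e : Vec ℕ n) → InversionSeq n e → SubsetOfEm101 S e →
       InversionSeq n (flipMap S e) × SubsetOfEm110 S (flipMap S e))
  × (∀ (e₁ e₂ : Vec ℕ n) → InversionSeq n e₁ → SubsetOfEm101 S e₁ →
       InversionSeq n e₂ → SubsetOfEm101 S e₂ →
       flipMap S e₁ ≡ flipMap S e₂ → e₁ ≡ e₂)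
  × (∀ (e′ : Vec ℕ n) → InversionSeq n e′ → SubsetOfEm110 S e′ →
       ∃ λ e → InversionSeq n e × SubsetOfEm101 S e × flipMap S e ≡ e′)
lemma3p5 n _ S = Forward.result S , injective , surjective
  where
  injective : ∀ (e₁ e₂ : Vec ℕ n) → InversionSeq n e₁ → SubsetOfEm101 S e₁ →
    InversionSeq n e₂ → SubsetOfEm101 S e₂ → flipMap S e₁ ≡ flipMap S e₂ → e₁ ≡ e₂
  injective e₁ e₂ inv₁ em₁ _ _ same = begin
    e₁                       ≡⟨ involutive e₁ ⟨
    flipMap S (flipMap S e₁) ≡⟨ cong (flipMap S) same ⟩
    flipMap S (flipMap S e₂) ≡⟨ involutive e₂ ⟩
    e₂                       ∎
    where
    open ≡-Reasoning
    open Bounded S (Forward.bounded S e₁ inv₁ em₁) renaming (flipMap-involutive to involutive)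

  surjective : ∀ (e′ : Vec ℕ n) → InversionSeq n e′ → SubsetOfEm110 S e′ →
    ∃ λ e → InversionSeq n e × SubsetOfEm101 S e × flipMap S e ≡ e′
  surjective e′ inv em = flipMap S e′ , proj₁ flipped , proj₂ flipped ,
    Bounded.flipMap-involutive S (Backward.bounded S e′ inv em) e′
    where flipped = Backward.result S e′ inv em
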